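{- Let $m\ge 4$, $n\ge 2$, and let $T$ be a triangulation of the grid-covered cylinder graph $G_{m,n}$ that contains neither $W_5$ nor $W_7$ as an induced subgraph. Then for each $i$ with $2\le i\le n$, all cells of layer $L_i$ are of the same type (all of type $A$ or all of type $B$).
   Context: $G_{m,n}$ has vertex set $\{v_{ij}: 0\le i\le n,\ 0\le j\le m-1\}$, horizontal edges $v_{ij}v_{i,j+1}$ (second index mod $m$) and vertical edges $v_{ij}v_{i+1,j}$ ($0\le i\le n-1$). Its cells are the 4-cycles $v_{ij}v_{i+1,j}v_{i+1,j+1}v_{i,j+1}$ (second index mod $m$); the cell with first index $i$ lies in layer $L_{i+1}$ ($0\le i\le n-1$). A triangulation of $G_{m,n}$ adds to each cell exactly one of its two diagonals as an edge (a diagonal edge). For $1\le i\le n-1$, the cell $C=v_{ij}v_{i+1,j}v_{i+1,j+1}v_{i,j+1}$ (in layer $L_{i+1}$) is of type $A$ if its diagonal edge shares no vertex with the diagonal edge of the cell $v_{i-1,j}v_{ij}v_{i,j+1}v_{i-1,j+1}$ directly below it (in layer $L_i$), and of type $B$ otherwise. $W_k$ denotes the wheel graph: a cycle $C_k$ plus a vertex adjacent to all cycle vertices. -}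

module Defs where

open import Data.Nat using (ℕ; zero; suc; _≤_; _<_; _∸_)
open import Data.Nat.Properties using (_≟_)
open import Data.Bool using (Bool; true; false)
open import Data.Fin using (Fin; toℕ) renaming (zero to fzero; suc to fsuc)
open import Data.Product using (_×_; _,_; proj₁; proj₂; Σ)
open import Data.Sum using (_⊎_)
open import Relation.Nullary using (¬_; yes; no)
open import Relation.Binary.PropositionalEquality using (_≡_)
open import Function.Bundles using (_⇔_)

sucMod : ℕ → ℕ → ℕ
sucMod m j with suc j ≟ m
... | yes _ = 0
... | no  _ = suc j

V : Set
V = ℕ × ℕ

ValidV : ℕ → ℕ → V → Set
ValidV m n (i , j) = (i ≤ n) × (j < m)

-- A triangulation: for each cell (first index i < n, second index j < m)
-- a choice of diagonal.  false : v_{ij} v_{i+1,j+1};  true : v_{i+1,j} v_{i,j+1}.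
-- Values outside the range i < n, j < m are irrelevant.
Triangulation : Set
Triangulation = ℕ → ℕ → Bool

diag : ℕ → Triangulation → ℕ → ℕ → V × V
diag m T i j with T i j
... | false = (i , j) , (suc i , sucMod m j)
... | true  = (suc i , j) , (i , sucMod m j)

data E (m n : ℕ) (T : Triangulation) : V → V → Set where
  horiz : ∀ {i j} → i ≤ n → j < m → E m n T (i , j) (i , sucMod m j)
  vert  : ∀ {i j} → i < n → j < m → E m n T (i , j) (suc i , j)
  dg    : ∀ {i j} → i < n → j < m →
          E m n T (proj₁ (diag m T i j)) (proj₂ (diag m T i j))

Adj : ℕ → ℕ → Triangulation → V → V → Set
Adj m n T u v = E m n T u v ⊎ E m n T v u

-- Wheel W_k on Fin (suc k): vertex 0 is the hub, fsuc a (a = 0..k-1) the rim cycle.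
data WAdj (k : ℕ) : Fin (suc k) → Fin (suc k) → Set where
  hubˡ : ∀ {a} → WAdj k fzero (fsuc a)
  hubʳ : ∀ {a} → WAdj k (fsuc a) fzero
  rimˡ : ∀ {a b : Fin k} → toℕ b ≡ sucMod k (toℕ a) → WAdj k (fsuc a) (fsuc b)
  rimʳ : ∀ {a b : Fin k} → toℕ a ≡ sucMod k (toℕ b) → WAdj k (fsuc a) (fsuc b)

HasInducedWheel : ℕ → ℕ → Triangulation → ℕ → Set
HasInducedWheel m n T k =
  Σ (Fin (suc k) → V) λ f →
    ((a : Fin (suc k)) → ValidV m n (f a)) ×
    ((a b : Fin (suc k)) → f a ≡ f b → a ≡ b) ×
    ((a b : Fin (suc k)) → WAdj k a b ⇔ Adj m n T (f a) (f b))

SharesVertex : V × V → V × V → Set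
SharesVertex (a , b) (c , d) = (a ≡ c) ⊎ (a ≡ d) ⊎ (b ≡ c) ⊎ (b ≡ d)

-- cell with first index i (1 ≤ i ≤ n-1), second index j
TypeA : ℕ → Triangulation → ℕ → ℕ → Set
TypeA m T i j = ¬ SharesVertex (diag m T i j) (diag m T (i ∸ 1) j)

TypeB : ℕ → Triangulation → ℕ → ℕ → Set
TypeB m T i j = SharesVertex (diag m T i j) (diag m T (i ∸ 1) j)

module Submission where

-- Write crossed τ r j for "the diagonals of cells (r+1 , j) and (r , j) point in
-- different directions"; the cell (r+1 , j) has type B exactly when this holds.
-- Around the centre v_{r+1,j+1} of the 2×2 block of cells in rows r, r+1 and
-- columns j, j+1, the neighbours of the centre form an induced wheel whose rim has
-- length 4 + (number of block diagonals through the centre).  That number is odd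
-- exactly when crossed τ r j ≠ crossed τ r (j+1); so excluding W₅ and W₇ makes
-- crossed τ r invariant under one step around the cylinder, hence constant on a
-- layer, and the layer has a single type.

open import Data.Bool using (Bool; true; false; if_then_else_; _xor_)
import Data.Bool.Properties as Bool
open import Data.Fin using (Fin; toℕ) renaming (zero to fzero; suc to fsuc)
import Data.Fin.Properties as Fin
open import Data.Fin.Properties using (all?)
open import Data.List using (List; []; _∷_; _++_; length; lookup)
open import Data.Nat using (ℕ; zero; suc; _+_; _≤_; _<_; _∸_; z≤n; s≤s; s≤s⁻¹; z<s)
open import Data.Nat.Properties
open import Data.Product using (_×_; _,_; proj₁; proj₂; ∃)
open import Data.Product.Properties using (≡-dec)
open import Data.Sum using (_⊎_; inj₁; inj₂)
import Data.Sum as Sum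
open import Function using (_∘_)
open import Function.Bundles using (_⇔_; mk⇔; Equivalence)
open import Relation.Binary.Definitions using (tri<; tri≈; tri>)
open import Relation.Binary.PropositionalEquality
open import Relation.Nullary using (¬_; Dec; yes; no; contradiction)
open import Relation.Nullary.Decidable using (True; toWitness; _×-dec_; _⊎-dec_; _→-dec_)

open import Defs

sucMod-below : ∀ {m j} → suc j < m → sucMod m j ≡ suc j
sucMod-below {m} {j} lt with suc j ≟ m
... | yes refl = contradiction lt (<-irrefl refl)
... | no _     = refl

sucMod-seam : ∀ {m j} → suc j ≡ m → sucMod m j ≡ 0
sucMod-seam {m} {j} eq with suc j ≟ m
... | yes _   = refl
... | no  neq = contradiction eq neq

sucMod-< : ∀ {m j} → j < m → sucMod m j < m
sucMod-< {m} {j} j<m with suc j ≟ m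
... | yes _   = ≤-trans (s≤s z≤n) j<m
... | no  neq = ≤∧≢⇒< j<m neq

shift : ℕ → ℕ → ℕ → ℕ
shift m j zero    = j
shift m j (suc d) = sucMod m (shift m j d)

shift-< : ∀ {m j} d → j < m → shift m j d < m
shift-< zero    j<m = j<m
shift-< (suc d) j<m = sucMod-< (shift-< d j<m)

shift-+ : ∀ m j d e → shift m j (d + e) ≡ shift m (shift m j d) e
shift-+ m j d zero    = cong (shift m j) (+-identityʳ d)
shift-+ m j d (suc e) = begin
  shift m j (d + suc e)          ≡⟨ cong (shift m j) (+-suc d e) ⟩
  sucMod m (shift m j (d + e))   ≡⟨ cong (sucMod m) (shift-+ m j d e) ⟩
  shift m (shift m j d) (suc e)  ∎
  where open ≡-Reasoning

shift-below : ∀ {m j} d → j + d < m → shift m j d ≡ j + d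
shift-below {j = j} zero    _  = sym (+-identityʳ j)
shift-below {m} {j} (suc d) lt = begin
  sucMod m (shift m j d)  ≡⟨ cong (sucMod m) (shift-below d (<-trans (n<1+n (j + d)) lt′)) ⟩
  sucMod m (j + d)        ≡⟨ sucMod-below lt′ ⟩
  suc (j + d)             ≡⟨ +-suc j d ⟨
  j + suc d               ∎
  where
  open ≡-Reasoning
  lt′ : suc (j + d) < m
  lt′ = subst (_< m) (+-suc j d) lt

shift-seam : ∀ {m j} k → suc (j + k) ≡ m → shift m j (suc k) ≡ 0
shift-seam {m} {j} k seam = begin
  sucMod m (shift m j k)  ≡⟨ cong (sucMod m) (shift-below k (subst (suc (j + k) ≤_) seam ≤-refl)) ⟩
  sucMod m (j + k)        ≡⟨ sucMod-seam seam ⟩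
  0                       ∎
  where open ≡-Reasoning

-- If j + d < m this is plain addition; otherwise the walk passes the seam after
-- suc k steps (m = suc (j + k)) and then stands at column d ∸ suc k, which would
-- have to be j, forcing d = m.
shift-returns : ∀ {m j d} → j < m → 0 < d → d < m → shift m j d ≢ j
shift-returns {m} {j} {d} j<m 0<d d<m returns with j + d <? m
... | yes below = <⇒≢ (m<m+n j 0<d) (sym (trans (sym (shift-below d below)) returns))
... | no  above = <-irrefl d≡m d<m
  where
  open ≡-Reasoning
  gap : ∃ λ k → suc j + k ≡ m
  gap = m≤n⇒∃[o]m+o≡n j<m
  k = proj₁ gap
  past-seam : suc k ≤ d
  past-seam = +-cancelˡ-≤ j (suc k) d
    (subst (_≤ j + d) (trans (sym (proj₂ gap)) (sym (+-suc j k))) (≮⇒≥ above))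
  rest : ∃ λ e → suc k + e ≡ d
  rest = m≤n⇒∃[o]m+o≡n past-seam
  e = proj₁ rest
  e<m : e < m
  e<m = ≤-<-trans (subst (e ≤_) (proj₂ rest) (m≤n+m e (suc k))) d<m
  e≡j : e ≡ j
  e≡j = begin
    e                                ≡⟨ shift-below {m} {0} e e<m ⟨
    shift m 0 e                      ≡⟨ cong (λ c → shift m c e) (shift-seam k (proj₂ gap)) ⟨
    shift m (shift m j (suc k)) e    ≡⟨ shift-+ m j (suc k) e ⟨
    shift m j (suc k + e)            ≡⟨ cong (shift m j) (proj₂ rest) ⟩
    shift m j d                      ≡⟨ returns ⟩
    j                                ∎
  d≡m : d ≡ m
  d≡m = begin
    d            ≡⟨ proj₂ rest ⟨
    suc k + e    ≡⟨ cong (suc k +_) e≡j ⟩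
    suc (k + j)  ≡⟨ cong suc (+-comm k j) ⟩
    suc j + k    ≡⟨ proj₂ gap ⟩
    m            ∎

sucMod-moves : ∀ {m j} → 1 < m → j < m → sucMod m j ≢ j
sucMod-moves 1<m j<m = shift-returns {d = 1} j<m z<s 1<m

shift-apart : ∀ {m j x x′} → j < m → x < x′ → x′ < m → shift m j x′ ≢ shift m j x
shift-apart {m} {j} {x} {x′} j<m x<x′ x′<m =
  subst (_≢ shift m j x) (sym moved) (shift-returns (shift-< x j<m) z<s (≤-<-trans step≤x′ x′<m))
  where
  open ≡-Reasoning
  split : ∃ λ e → suc x + e ≡ x′
  split = m≤n⇒∃[o]m+o≡n x<x′
  e = proj₁ split
  step≤x′ : suc e ≤ x′
  step≤x′ = subst (suc e ≤_) (proj₂ split) (s≤s (m≤n+m e x))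
  moved : shift m j x′ ≡ shift m (shift m j x) (suc e)
  moved = begin
    shift m j x′                   ≡⟨ cong (shift m j) (trans (sym (proj₂ split)) (sym (+-suc x e))) ⟩
    shift m j (x + suc e)          ≡⟨ shift-+ m j x (suc e) ⟩
    shift m (shift m j x) (suc e)  ∎

shift-injective : ∀ {m j y y′} → j < m → y < m → y′ < m → shift m j y ≡ shift m j y′ → y ≡ y′
shift-injective {y = y} {y′} j<m y<m y′<m eq with <-cmp y y′
... | tri≈ _ y≡y′ _ = y≡y′
... | tri< y<y′ _ _ = contradiction (sym eq) (shift-apart j<m y<y′ y′<m)
... | tri> _ _ y′<y = contradiction eq (shift-apart j<m y′<y y<m)

constant-around : ∀ {m} {A : Set} (f : ℕ → A) → (∀ j → j < m → f j ≡ f (sucMod m j)) →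
                  ∀ j → j < m → f j ≡ f 0
constant-around f step zero    _    = refl
constant-around {m} f step (suc j) sj<m = begin
  f (suc j)         ≡⟨ cong f (sucMod-below sj<m) ⟨
  f (sucMod m j)    ≡⟨ step j j<m ⟨
  f j               ≡⟨ constant-around f step j j<m ⟩
  f 0               ∎
  where
  open ≡-Reasoning
  j<m = <-trans (n<1+n j) sj<m

diag-rising : ∀ {m τ i j} → τ i j ≡ false → diag m τ i j ≡ ((i , j) , (suc i , sucMod m j))
diag-rising eq rewrite eq = refl

diag-falling : ∀ {m τ i j} → τ i j ≡ true → diag m τ i j ≡ ((suc i , j) , (i , sucMod m j))
diag-falling eq rewrite eq = refl

rising-edge : ∀ {m n τ i j} → τ i j ≡ false → i < n → j < m → E m n τ (i , j) (suc i , sucMod m j)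
rising-edge {m} {n} {τ} eq i<n j<m = subst₂ (E m n τ) (cong proj₁ d) (cong proj₂ d) (dg i<n j<m)
  where d = diag-rising {m} {τ} eq

falling-edge : ∀ {m n τ i j} → τ i j ≡ true → i < n → j < m → E m n τ (suc i , j) (i , sucMod m j)
falling-edge {m} {n} {τ} eq i<n j<m = subst₂ (E m n τ) (cong proj₁ d) (cong proj₂ d) (dg i<n j<m)
  where d = diag-falling {m} {τ} eq

-- Window coordinates (a , b), a , b ≤ 2, stand for v_{r+a, j+b}.
Point : Set
Point = ℕ × ℕ

InWindow : Point → Set
InWindow (a , b) = a ≤ 2 × b ≤ 2

-- Diagonal choices of the 2×2 block of cells (x , y), x , y ≤ 1, of the window.
Block : Set
Block = ℕ → ℕ → Bool

LocalEdge : Block → Point → Point → Set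
LocalEdge β (a , b) (a′ , b′) =
    (a′ ≡ a × b′ ≡ suc b)
  ⊎ (a′ ≡ suc a × b′ ≡ b)
  ⊎ (b′ ≡ suc b × ((a′ ≡ suc a × β a b ≡ false) ⊎ (a ≡ suc a′ × β a′ b ≡ true)))

LocalAdj : Block → Point → Point → Set
LocalAdj β p q = LocalEdge β p q ⊎ LocalEdge β q p

WindowWheel : Block → (k : ℕ) → (Fin (suc k) → Point) → Set
WindowWheel β k g =
  (∀ a → InWindow (g a)) ×
  (∀ a b → (g a ≡ g b → a ≡ b) ×
           (WAdj k a b → LocalAdj β (g a) (g b)) × (LocalAdj β (g a) (g b) → WAdj k a b))

wadj? : ∀ k (a b : Fin (suc k)) → Dec (WAdj k a b)
wadj? k fzero    fzero    = no λ ()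
wadj? k fzero    (fsuc b) = yes hubˡ
wadj? k (fsuc a) fzero    = yes hubʳ
wadj? k (fsuc a) (fsuc b) with toℕ b ≟ sucMod k (toℕ a) | toℕ a ≟ sucMod k (toℕ b)
... | yes next | _        = yes (rimˡ next)
... | no _     | yes prev = yes (rimʳ prev)
... | no ¬next | no ¬prev = no λ { (rimˡ next) → ¬next next ; (rimʳ prev) → ¬prev prev }

localEdge? : ∀ β p q → Dec (LocalEdge β p q)
localEdge? β (a , b) (a′ , b′) =
        (a′ ≟ a ×-dec b′ ≟ suc b)
  ⊎-dec (a′ ≟ suc a ×-dec b′ ≟ b)
  ⊎-dec (b′ ≟ suc b ×-dec ((a′ ≟ suc a ×-dec β a b Bool.≟ false) ⊎-dec (a ≟ suc a′ ×-dec β a′ b Bool.≟ true)))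

localAdj? : ∀ β p q → Dec (LocalAdj β p q)
localAdj? β p q = localEdge? β p q ⊎-dec localEdge? β q p

windowWheel? : ∀ β k g → Dec (WindowWheel β k g)
windowWheel? β k g =
  all? (λ a → proj₁ (g a) ≤? 2 ×-dec proj₂ (g a) ≤? 2) ×-dec
  all? (λ a → all? λ b →
    (≡-dec _≟_ _≟_ (g a) (g b) →-dec a Fin.≟ b) ×-dec
    (wadj? k a b →-dec localAdj? β (g a) (g b)) ×-dec
    (localAdj? β (g a) (g b) →-dec wadj? k a b))

-- Horizontal edges
-- leave the window's last column, so the columns j, …, j+3 must be distinct: 4 ≤ m.
module Window (m n : ℕ) (4≤m : 4 ≤ m) (τ : Triangulation) (r j : ℕ) (j<m : j < m) (r+2≤n : 2 + r ≤ n)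
              (β : Block) (agrees : ∀ x y → x ≤ 1 → y ≤ 1 → τ (x + r) (shift m j y) ≡ β x y) where

  pos : Point → V
  pos (a , b) = (a + r , shift m j b)

  row-≤ : ∀ {a} → a ≤ 2 → a + r ≤ n
  row-≤ a≤2 = ≤-trans (+-monoˡ-≤ r a≤2) r+2≤n

  row-inj : ∀ {a a′} → a + r ≡ a′ + r → a ≡ a′
  row-inj {a} {a′} = +-cancelʳ-≡ r a a′

  col-inj : ∀ {b b′} → b ≤ 3 → b′ ≤ 3 → shift m j b ≡ shift m j b′ → b ≡ b′
  col-inj b≤3 b′≤3 = shift-injective j<m (≤-trans (s≤s b≤3) 4≤m) (≤-trans (s≤s b′≤3) 4≤m)

  pos-injective : ∀ {p q} → InWindow p → InWindow q → pos p ≡ pos q → p ≡ q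
  pos-injective (_ , b≤2) (_ , b′≤2) eq =
    cong₂ _,_ (row-inj (cong proj₁ eq)) (col-inj (m≤n⇒m≤1+n b≤2) (m≤n⇒m≤1+n b′≤2) (cong proj₂ eq))

  complete : ∀ p q → InWindow p → InWindow q → LocalEdge β p q → E m n τ (pos p) (pos q)
  complete (a , b) _ (a≤2 , _) _ (inj₁ (refl , refl)) = horiz (row-≤ a≤2) (shift-< b j<m)
  complete (a , b) _ _ (a′≤2 , _) (inj₂ (inj₁ (refl , refl))) = vert (row-≤ a′≤2) (shift-< b j<m)
  complete (a , b) _ _ (a′≤2 , b′≤2) (inj₂ (inj₂ (refl , inj₁ (refl , rising)))) =
    rising-edge (trans (agrees a b (s≤s⁻¹ a′≤2) (s≤s⁻¹ b′≤2)) rising) (row-≤ a′≤2) (shift-< b j<m)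
  complete (_ , b) (a′ , _) (a≤2 , _) (_ , b′≤2) (inj₂ (inj₂ (refl , inj₂ (refl , falling)))) =
    falling-edge (trans (agrees a′ b (s≤s⁻¹ a≤2) (s≤s⁻¹ b′≤2)) falling) (row-≤ a≤2) (shift-< b j<m)

  -- Conversely, a diagonal of τ between window vertices is a diagonal of the model;
  -- its endpoints determine the cell, whose choice β records.
  rising-sound : ∀ {i jj} p q → InWindow p → InWindow q → τ i jj ≡ false →
                 i ≡ proj₁ (pos p) → jj ≡ proj₂ (pos p) → suc i ≡ proj₁ (pos q) → sucMod m jj ≡ proj₂ (pos q) →
                 LocalEdge β p q
  rising-sound (a , b) (a′ , b′) (_ , b≤2) (a′≤2 , b′≤2) τij refl refl row col
    with row-inj {suc a} row | col-inj (s≤s b≤2) (m≤n⇒m≤1+n b′≤2) col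
  ... | refl | refl = inj₂ (inj₂ (refl , inj₁ (refl , trans (sym (agrees a b (s≤s⁻¹ a′≤2) (s≤s⁻¹ b′≤2))) τij)))

  falling-sound : ∀ {i jj} p q → InWindow p → InWindow q → τ i jj ≡ true →
                  suc i ≡ proj₁ (pos p) → jj ≡ proj₂ (pos p) → i ≡ proj₁ (pos q) → sucMod m jj ≡ proj₂ (pos q) →
                  LocalEdge β p q
  falling-sound (a , b) (a′ , b′) (a≤2 , b≤2) (_ , b′≤2) τij row refl refl col
    with row-inj {suc a′} row | col-inj (s≤s b≤2) (m≤n⇒m≤1+n b′≤2) col
  ... | refl | refl = inj₂ (inj₂ (refl , inj₂ (refl , trans (sym (agrees a′ b (s≤s⁻¹ a≤2) (s≤s⁻¹ b′≤2))) τij)))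

  sound : ∀ {u v} → E m n τ u v → ∀ p q → InWindow p → InWindow q → u ≡ pos p → v ≡ pos q →
          LocalEdge β p q
  sound (horiz _ _) (a , b) (a′ , b′) (_ , b≤2) (_ , b′≤2) refl at-q =
    inj₁ (sym (row-inj (cong proj₁ at-q)) , sym (col-inj (s≤s b≤2) (m≤n⇒m≤1+n b′≤2) (cong proj₂ at-q)))
  sound (vert _ _) (a , b) (a′ , b′) (_ , b≤2) (_ , b′≤2) refl at-q =
    inj₂ (inj₁ (sym (row-inj (cong proj₁ at-q)) ,
                sym (col-inj (m≤n⇒m≤1+n b≤2) (m≤n⇒m≤1+n b′≤2) (cong proj₂ at-q))))
  sound (dg {i} {jj} _ _) p q wp wq at-p at-q with τ i jj in τij
  ... | false = rising-sound p q wp wq τij (cong proj₁ at-p) (cong proj₂ at-p) (cong proj₁ at-q) (cong proj₂ at-q)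
  ... | true  = falling-sound p q wp wq τij (cong proj₁ at-p) (cong proj₂ at-p) (cong proj₁ at-q) (cong proj₂ at-q)

  adj⇔local : ∀ p q → InWindow p → InWindow q → Adj m n τ (pos p) (pos q) ⇔ LocalAdj β p q
  adj⇔local p q wp wq = mk⇔
    (Sum.map (λ e → sound e p q wp wq refl refl) (λ e → sound e q p wq wp refl refl))
    (Sum.map (complete p q wp wq) (complete q p wq wp))

  window-wheel : ∀ k (g : Fin (suc k) → Point) → WindowWheel β k g → HasInducedWheel m n τ k
  window-wheel k g (inside , related) = pos ∘ g , valid , injective , adjacency
    where
    valid : ∀ a → ValidV m n (pos (g a))
    valid a = row-≤ (proj₁ (inside a)) , shift-< (proj₂ (g a)) j<m
    injective : ∀ a b → pos (g a) ≡ pos (g b) → a ≡ b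
    injective a b eq = proj₁ (related a b) (pos-injective (inside a) (inside b) eq)
    adjacency : ∀ a b → WAdj k a b ⇔ Adj m n τ (pos (g a)) (pos (g b))
    adjacency a b with related a b | adj⇔local (g a) (g b) (inside a) (inside b)
    ... | _ , to , from | local = mk⇔ (Equivalence.from local ∘ to) (from ∘ Equivalence.to local)

block : Bool → Bool → Bool → Bool → Block
block b₀₀ b₀₁ b₁₀ b₁₁ 0 0 = b₀₀
block b₀₀ b₀₁ b₁₀ b₁₁ 0 1 = b₀₁
block b₀₀ b₀₁ b₁₀ b₁₁ 1 0 = b₁₀
block b₀₀ b₀₁ b₁₀ b₁₁ 1 1 = b₁₁
block b₀₀ b₀₁ b₁₀ b₁₁ _ _ = false

-- The neighbours of the centre (1 , 1) in cyclic order: the four edge midpoints,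
-- and each corner whose cell's diagonal runs through the centre.
rim : Bool → Bool → Bool → Bool → List Point
rim b₀₀ b₀₁ b₁₀ b₁₁ =
     (if b₀₀ then [] else (0 , 0) ∷ []) ++ (0 , 1) ∷ (if b₀₁ then (0 , 2) ∷ [] else [])
  ++ (1 , 2) ∷ (if b₁₁ then [] else (2 , 2) ∷ []) ++ (2 , 1) ∷ (if b₁₀ then (2 , 0) ∷ [] else [])
  ++ (1 , 0) ∷ []

wheelAround : ∀ b₀₀ b₀₁ b₁₀ b₁₁ → Fin (suc (length (rim b₀₀ b₀₁ b₁₀ b₁₁))) → Point
wheelAround b₀₀ b₀₁ b₁₀ b₁₁ = lookup ((1 , 1) ∷ rim b₀₀ b₀₁ b₁₀ b₁₁)

crossed : Triangulation → ℕ → ℕ → Bool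
crossed τ r j = τ (suc r) j xor τ r j

module Centre {m n : ℕ} (4≤m : 4 ≤ m) (τ : Triangulation) {r j : ℕ} (j<m : j < m) (r+2≤n : 2 + r ≤ n) where

  block-agrees : ∀ {b₀₀ b₀₁ b₁₀ b₁₁} →
                 τ r j ≡ b₀₀ → τ r (sucMod m j) ≡ b₀₁ → τ (suc r) j ≡ b₁₀ → τ (suc r) (sucMod m j) ≡ b₁₁ →
                 ∀ x y → x ≤ 1 → y ≤ 1 → τ (x + r) (shift m j y) ≡ block b₀₀ b₀₁ b₁₀ b₁₁ x y
  block-agrees e₀₀ _ _ _ 0 0 _ _ = e₀₀
  block-agrees _ e₀₁ _ _ 0 1 _ _ = e₀₁
  block-agrees _ _ e₁₀ _ 1 0 _ _ = e₁₀
  block-agrees _ _ _ e₁₁ 1 1 _ _ = e₁₁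
  block-agrees _ _ _ _ (suc (suc _)) _ (s≤s ()) _
  block-agrees _ _ _ _ _ (suc (suc _)) _ (s≤s ())

  centre-wheel : ∀ {b₀₀ b₀₁ b₁₀ b₁₁} →
                 τ r j ≡ b₀₀ → τ r (sucMod m j) ≡ b₀₁ → τ (suc r) j ≡ b₁₀ → τ (suc r) (sucMod m j) ≡ b₁₁ →
                 let k = length (rim b₀₀ b₀₁ b₁₀ b₁₁) in
                 True (windowWheel? (block b₀₀ b₀₁ b₁₀ b₁₁) k (wheelAround b₀₀ b₀₁ b₁₀ b₁₁)) →
                 HasInducedWheel m n τ k
  centre-wheel e₀₀ e₀₁ e₁₀ e₁₁ certified =
    Window.window-wheel m n 4≤m τ r j j<m r+2≤n _ (block-agrees e₀₀ e₀₁ e₁₀ e₁₁) _ _ (toWitness certified)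

  -- Without induced W₅ and W₇ the centre meets an even number of block diagonals,
  -- which says that crossing does not change from column j to column j+1.
  -- Each odd pattern is refuted by its wheel W₅ or W₇, certified by evaluation.
  even-block : ¬ HasInducedWheel m n τ 5 → ¬ HasInducedWheel m n τ 7 →
               crossed τ r j ≡ crossed τ r (sucMod m j)
  even-block noW₅ noW₇
    with τ r j in e₀₀ | τ r (sucMod m j) in e₀₁ | τ (suc r) j in e₁₀ | τ (suc r) (sucMod m j) in e₁₁
  ... | false | false | false | false = refl
  ... | false | false | false | true  = contradiction (centre-wheel e₀₀ e₀₁ e₁₀ e₁₁ _) noW₅
  ... | false | false | true  | false = contradiction (centre-wheel e₀₀ e₀₁ e₁₀ e₁₁ _) noW₇
  ... | false | false | true  | true  = refl
  ... | false | true  | false | false = contradiction (centre-wheel e₀₀ e₀₁ e₁₀ e₁₁ _) noW₇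
  ... | false | true  | false | true  = refl
  ... | false | true  | true  | false = refl
  ... | false | true  | true  | true  = contradiction (centre-wheel e₀₀ e₀₁ e₁₀ e₁₁ _) noW₇
  ... | true  | false | false | false = contradiction (centre-wheel e₀₀ e₀₁ e₁₀ e₁₁ _) noW₅
  ... | true  | false | false | true  = refl
  ... | true  | false | true  | false = refl
  ... | true  | false | true  | true  = contradiction (centre-wheel e₀₀ e₀₁ e₁₀ e₁₁ _) noW₅
  ... | true  | true  | false | false = refl
  ... | true  | true  | false | true  = contradiction (centre-wheel e₀₀ e₀₁ e₁₀ e₁₁ _) noW₅
  ... | true  | true  | true  | false = contradiction (centre-wheel e₀₀ e₀₁ e₁₀ e₁₁ _) noW₇
  ... | true  | true  | true  | true  = refl

-- Parallel diagonals in vertically adjacent cells are disjoint: type A.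
-- (Mixed directions contradict the hypothesis and are discharged by the coverage checker.)
parallel⇒typeA : ∀ {m} τ r {j} → 1 < m → j < m → crossed τ r j ≡ false → TypeA m τ (suc r) j
parallel⇒typeA {m} τ r {j} 1<m j<m parallel with τ (suc r) j | τ r j
... | false | false = λ { (inj₁ ()) ; (inj₂ (inj₁ e)) → sucMod-moves 1<m j<m (sym (cong proj₂ e))
                       ; (inj₂ (inj₂ (inj₁ ()))) ; (inj₂ (inj₂ (inj₂ ()))) }
... | true  | true  = λ { (inj₁ ()) ; (inj₂ (inj₁ ())) ; (inj₂ (inj₂ (inj₁ e))) → sucMod-moves 1<m j<m (cong proj₂ e)
                       ; (inj₂ (inj₂ (inj₂ ()))) }

-- Crossing diagonals in vertically adjacent cells meet on the shared side: type B.
crossing⇒typeB : ∀ {m} τ r {j} → crossed τ r j ≡ true → TypeB m τ (suc r) j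
crossing⇒typeB {m} τ r {j} crossing with τ (suc r) j | τ r j
... | false | true  = inj₁ refl
... | true  | false = inj₂ (inj₂ (inj₂ refl))

layer-uniform : ∀ {m n} → 4 ≤ m → (τ : Triangulation) → ¬ HasInducedWheel m n τ 5 → ¬ HasInducedWheel m n τ 7 →
                ∀ {r} → 2 + r ≤ n → ∀ j → j < m → crossed τ r j ≡ crossed τ r 0
layer-uniform 4≤m τ noW₅ noW₇ {r} r+2≤n =
  constant-around (crossed τ r) (λ j j<m → Centre.even-block 4≤m τ j<m r+2≤n noW₅ noW₇)

lemma4 : (m n : ℕ) → 4 ≤ m → 2 ≤ n → (T : Triangulation) →
         ¬ HasInducedWheel m n T 5 → ¬ HasInducedWheel m n T 7 →
         (i : ℕ) → 2 ≤ i → i ≤ n →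
         (((j : ℕ) → j < m → TypeA m T (i ∸ 1) j) ⊎
          ((j : ℕ) → j < m → TypeB m T (i ∸ 1) j))
lemma4 _ _ _ _ _ _ _ (suc zero) (s≤s ()) _
lemma4 m n 4≤m _ τ noW₅ noW₇ (suc (suc r)) _ r+2≤n with crossed τ r 0 in crossed₀
... | false = inj₁ λ j j<m → parallel⇒typeA τ r 1<m j<m (trans (layer-uniform 4≤m τ noW₅ noW₇ r+2≤n j j<m) crossed₀)
  where 1<m = ≤-trans (s≤s (s≤s z≤n)) 4≤m
... | true  = inj₂ λ j j<m → crossing⇒typeB τ r (trans (layer-uniform 4≤m τ noW₅ noW₇ r+2≤n j j<m) crossed₀)
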